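{- There exists a Jónsson–Tarski algebra with universe $\omega$ which is a Jónsson algebra.
   Context: A Jónsson–Tarski algebra is an algebra $\langle A;\cdot,\ell,r\rangle$ with a binary operation $\cdot$ and unary operations $\ell,r$ satisfying the identities $\ell(x\cdot y)=x$, $r(x\cdot y)=y$, $\ell(z)\cdot r(z)=z$. A Jónsson algebra is an infinite algebra in a countable algebraic language which has no proper subalgebra of the same cardinality as itself. -}

module Defs where

open import Data.Nat using (ℕ)
open import Relation.Binary.PropositionalEquality using (_≡_)
open import Function.Definitions using (Injective)
open import Data.Product using (Σ; _×_)

record JTAlgebraOnℕ : Set where
  field
    _·_ : ℕ → ℕ → ℕ
    ℓ   : ℕ → ℕ
    r   : ℕ → ℕ
    ℓ-· : ∀ x y → ℓ (x · y) ≡ x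
    r-· : ∀ x y → r (x · y) ≡ y
    ℓ·r : ∀ z → ℓ z · r z ≡ z

IsSubalgebra : JTAlgebraOnℕ → (ℕ → Set) → Set
IsSubalgebra A S =
  (∀ x y → S x → S y → S (x · y)) × (∀ x → S x → S (ℓ x)) × (∀ x → S x → S (r x))
  where open JTAlgebraOnℕ A

-- S has the cardinality of the universe ℕ (= ω): there is an injection of
-- ℕ into S (the reverse bound holds automatically since S ⊆ ℕ).
HasCardinalityω : (ℕ → Set) → Set
HasCardinalityω S = Σ (ℕ → ℕ) (λ f → Injective _≡_ _≡_ f × (∀ k → S (f k)))

-- Jónsson algebra (the universe ℕ is infinite and the language is finite,
-- hence countable): every subalgebra of the same cardinality as the whole
-- algebra is the whole algebra.
IsJonsson : JTAlgebraOnℕ → Set₁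
IsJonsson A = (S : ℕ → Set) → IsSubalgebra A S → HasCardinalityω S → ∀ n → S n

module Submission where

-- A Jónsson–Tarski algebra on ω is the same thing as a bijection ℕ × ℕ ≅ ℕ:
-- x · y is the pairing of (x , y) and ℓ, r are the two components of the
-- inverse.  We use the Cantor pairing  x · y = T(x + y) + y,  where T is the
-- triangular numbers, and show that the resulting algebra is Jónsson.
--
-- The argument splits into two parts.
--   1. A Jónsson criterion for an arbitrary Jónsson–Tarski algebra on ℕ:
--      if 0 · 0 = 0, r 1 = 0 and every n ≥ 2 has ℓ n < n and r n < n, then
--      (a) descending along ℓ and r from any nonzero element of a
--          subalgebra reaches 1, hence also 0 = r 1;
--      (b) by strong induction, 0 and 1 generate everything under ·;
--      (c) a subalgebra of cardinality ω contains a nonzero element.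
--   2. The Cantor pairing is a bijection and satisfies the hypotheses of the
--      criterion; the theorem is the combination of the two.

open import Defs
open import Data.Product using (Σ; _,_; proj₁; proj₂; _×_)
open import Data.Sum using (_⊎_; inj₁; inj₂)
open import Data.Nat using (ℕ; zero; suc; _+_; _≤_; _<_; z≤n; s≤s; _≟_)
open import Data.Nat.Properties
  using (≤-trans; <-≤-trans; m≤m+n; m<m+n; m<n+m; +-monoˡ-≤; +-suc; +-comm;
         +-identityʳ; suc-injective; 0≢1+n)
open import Data.Nat.Induction using (<-rec)
open import Relation.Binary.PropositionalEquality
  using (_≡_; _≢_; refl; sym; trans; cong; cong₂; subst; module ≡-Reasoning)
open import Relation.Nullary using (yes; no; contradiction)

module JonssonCriterion (A : JTAlgebraOnℕ) where
  open JTAlgebraOnℕ A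

  DescendingFrom2 : Set
  DescendingFrom2 = ∀ n → 2 ≤ n → ℓ n < n × r n < n

  nonzeroComponent : 0 · 0 ≡ 0 → ∀ n → n ≢ 0 → ℓ n ≢ 0 ⊎ r n ≢ 0
  nonzeroComponent 0·0≡0 n n≢0 with ℓ n ≟ 0 | r n ≟ 0
  ... | no ℓn≢0 | _       = inj₁ ℓn≢0
  ... | yes _   | no rn≢0 = inj₂ rn≢0
  ... | yes ℓn≡0 | yes rn≡0 = contradiction n≡0 n≢0
    where
    open ≡-Reasoning
    n≡0 : n ≡ 0
    n≡0 = begin
      n         ≡⟨ sym (ℓ·r n) ⟩
      ℓ n · r n ≡⟨ cong₂ _·_ ℓn≡0 rn≡0 ⟩
      0 · 0     ≡⟨ 0·0≡0 ⟩
      0         ∎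

  -- (a) A set closed under ℓ and r that contains a nonzero element
  -- contains 1: follow nonzero components downwards until reaching 1.
  reachesOne : 0 · 0 ≡ 0 → DescendingFrom2 → (S : ℕ → Set) →
               (∀ x → S x → S (ℓ x)) → (∀ x → S x → S (r x)) →
               ∀ n → n ≢ 0 → S n → S 1
  reachesOne 0·0≡0 descending S closedℓ closedr =
    <-rec (λ n → n ≢ 0 → S n → S 1) descend
    where
    descend : ∀ n → (∀ {m} → m < n → m ≢ 0 → S m → S 1) → n ≢ 0 → S n → S 1
    descend zero          _  0≢0 _  = contradiction refl 0≢0
    descend (suc zero)    _  _   S1 = S1
    descend n@(suc (suc _)) ih n≢0 Sn with nonzeroComponent 0·0≡0 n n≢0
    ... | inj₁ ℓn≢0 = ih (proj₁ (descending n (s≤s (s≤s z≤n)))) ℓn≢0 (closedℓ n Sn)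
    ... | inj₂ rn≢0 = ih (proj₂ (descending n (s≤s (s≤s z≤n)))) rn≢0 (closedr n Sn)

  -- (b) A set closed under · that contains 0 and 1 is everything: each
  -- n ≥ 2 is the product ℓ n · r n of two smaller elements.
  generatedBy01 : DescendingFrom2 → (S : ℕ → Set) →
                  (∀ x y → S x → S y → S (x · y)) → S 0 → S 1 → ∀ n → S n
  generatedBy01 descending S closed· S0 S1 = <-rec S build
    where
    build : ∀ n → (∀ {m} → m < n → S m) → S n
    build zero          _  = S0
    build (suc zero)    _  = S1
    build n@(suc (suc _)) ih = subst S (ℓ·r n)
      (closed· (ℓ n) (r n) (ih (proj₁ smaller)) (ih (proj₂ smaller)))
      where
      smaller : ℓ n < n × r n < n
      smaller = descending n (s≤s (s≤s z≤n))

  -- (c) A set containing an injective image of ℕ has a nonzero element: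
  -- f 0 and f 1 are distinct, so one of them is nonzero.
  hasNonzero : (S : ℕ → Set) → HasCardinalityω S → Σ ℕ (λ n → n ≢ 0 × S n)
  hasNonzero S (f , injective , inS) with f 0 ≟ 0
  ... | no f0≢0 = f 0 , f0≢0 , inS 0
  ... | yes f0≡0 = f 1 , (λ f1≡0 → 0≢1+n (injective (trans f0≡0 (sym f1≡0)))) , inS 1

  jonssonCriterion : 0 · 0 ≡ 0 → r 1 ≡ 0 → DescendingFrom2 → IsJonsson A
  jonssonCriterion 0·0≡0 r1≡0 descending S (closed· , closedℓ , closedr) large =
    generatedBy01 descending S closed· S0 S1
    where
    S1 : S 1
    S1 with hasNonzero S large
    ... | n , n≢0 , Sn = reachesOne 0·0≡0 descending S closedℓ closedr n n≢0 Sn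

    S0 : S 0
    S0 = subst S r1≡0 (closedr 1 S1)

triangle : ℕ → ℕ
triangle zero    = zero
triangle (suc s) = suc s + triangle s

-- The Cantor pairing enumerates ℕ × ℕ diagonal by diagonal.
pair : ℕ → ℕ → ℕ
pair x y = triangle (x + y) + y

nextPair : ℕ × ℕ → ℕ × ℕ
nextPair (zero  , y) = (suc y , 0)
nextPair (suc x , y) = (x , suc y)

unpair : ℕ → ℕ × ℕ
unpair zero    = (0 , 0)
unpair (suc n) = nextPair (unpair n)

pair′ : ℕ × ℕ → ℕ
pair′ (x , y) = pair x y

pair-nextPair : ∀ p → pair′ (nextPair p) ≡ suc (pair′ p)
pair-nextPair (zero , y)
  rewrite +-identityʳ y | +-identityʳ (suc y + triangle y) = cong suc (+-comm y (triangle y))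
pair-nextPair (suc x , y)
  rewrite +-suc x y | +-suc (suc (x + y) + triangle (x + y)) y = refl

pair-unpair : ∀ n → pair′ (unpair n) ≡ n
pair-unpair zero    = refl
pair-unpair (suc n) = trans (pair-nextPair (unpair n)) (cong suc (pair-unpair n))

-- Injectivity of the pairing, in the form: the code of (x , y) unpairs to (x , y).
unpair-pair : ∀ n x y → pair x y ≡ n → unpair n ≡ (x , y)
unpair-pair zero    zero    zero    _ = refl
unpair-pair zero    zero    (suc y) ()
unpair-pair zero    (suc x) y       ()
unpair-pair (suc n) zero    zero    ()
unpair-pair (suc n) x       (suc y) code≡ =
  cong nextPair (unpair-pair n (suc x) y
    (suc-injective (trans (sym (pair-nextPair (suc x , y))) code≡)))
unpair-pair (suc n) (suc x) zero    code≡ =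
  cong nextPair (unpair-pair n zero x
    (suc-injective (trans (sym (pair-nextPair (zero , x))) code≡)))

cantorAlgebra : JTAlgebraOnℕ
cantorAlgebra = record
  { _·_ = pair
  ; ℓ   = λ n → proj₁ (unpair n)
  ; r   = λ n → proj₂ (unpair n)
  ; ℓ-· = λ x y → cong proj₁ (unpair-pair (pair x y) x y refl)
  ; r-· = λ x y → cong proj₂ (unpair-pair (pair x y) x y refl)
  ; ℓ·r = pair-unpair
  }

triangle-≥ : ∀ s → s ≤ triangle s
triangle-≥ zero    = z≤n
triangle-≥ (suc s) = m≤m+n (suc s) (triangle s)

triangle-> : ∀ s → 2 ≤ s → s < triangle s
triangle-> (suc zero)    (s≤s ())
triangle-> (suc (suc s)) _ = m<m+n (suc (suc s)) (s≤s z≤n)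

fst<pair : ∀ x y → 2 ≤ pair x y → x < pair x y
fst<pair x (suc y) _ =
  <-≤-trans (m<m+n x (s≤s z≤n))
    (≤-trans (triangle-≥ (x + suc y)) (m≤m+n (triangle (x + suc y)) (suc y)))
fst<pair x zero 2≤code rewrite +-identityʳ x | +-identityʳ (triangle x) =
  triangle-> x (triangle-≥2 x 2≤code)
  where
  -- Codes of (0 , 0) and (1 , 0) are 0 and 1, so a code ≥ 2 on the axis has x ≥ 2.
  triangle-≥2 : ∀ x → 2 ≤ triangle x → 2 ≤ x
  triangle-≥2 (suc (suc x)) _ = s≤s (s≤s z≤n)
  triangle-≥2 (suc zero) (s≤s ())

snd<pair : ∀ x y → 2 ≤ pair x y → y < pair x y
snd<pair zero    zero    ()
snd<pair (suc x) y       _ = m<n+m y (s≤s z≤n)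
snd<pair zero    (suc y) _ = m<n+m (suc y) (s≤s z≤n)

cantorDescending : JonssonCriterion.DescendingFrom2 cantorAlgebra
cantorDescending n 2≤n =
  subst (x <_) code≡n (fst<pair x y 2≤code) , subst (y <_) code≡n (snd<pair x y 2≤code)
  where
  x y : ℕ
  x = proj₁ (unpair n)
  y = proj₂ (unpair n)
  code≡n : pair x y ≡ n
  code≡n = pair-unpair n
  2≤code : 2 ≤ pair x y
  2≤code = subst (2 ≤_) (sym code≡n) 2≤n

theorem4p1 : Σ JTAlgebraOnℕ IsJonsson
theorem4p1 = cantorAlgebra , jonssonCriterion refl refl cantorDescending
  where open JonssonCriterion cantorAlgebra
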